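{- For each positive integer $k$, let $\mathcal{SB}(k)$ be the set of Cayley permutations all of whose configurations in their vertical evolution have at most $k$ slots. Then $\mathcal{SB}(k)$ is exactly the set of Cayley permutations that avoid every Cayley permutation of size $2k+1$ that is a derivation of a configuration of the form $\diamond\, a_1 \,\diamond\, a_2 \,\diamond \cdots \diamond\, a_k \,\diamond$ (with $k+1$ slots), where $a_1a_2\cdots a_k$ ranges over all Cayley permutations of size $k$.
   Context: A Cayley permutation is a word over the positive integers in which every integer between $1$ and its maximum occurs. Pattern containment: $w$ contains $p=p_1\cdots p_k$ if some subsequence of $w$ of length $k$ standardises to $p$ (standardisation replaces the smallest value by $1$, the next smallest by $2$, etc.); otherwise $w$ avoids $p$. Vertical evolution: a Cayley permutation is built from the empty word by inserting its entries in increasing order of value, and among equal values from left to right. A configuration is the word recording the entries placed so far in their relative positions together with one slot symbol $\diamond$ for each maximal block of consecutive positions not yet filled (the evolution starts from $\diamond$). A derivation of a configuration $c$ is a Cayley permutation whose vertical evolution contains $c$ as one of its configurations. -}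

module Defs where

open import Data.Nat using (ℕ; zero; suc; _+_; _*_; _≤_; _<_; _⊔_; _≤?_; _<ᵇ_; _≡ᵇ_)
open import Data.Nat.Properties using (_≟_)
open import Data.Bool using (Bool; true; false; _∨_; _∧_; if_then_else_)
open import Data.List using (List; []; _∷_; length; map; filter; filterᵇ; deduplicate; zip; upTo; foldr; concatMap)
open import Data.List.Relation.Unary.All using (All)
open import Data.List.Membership.Propositional using (_∈_)
open import Data.List.Relation.Binary.Sublist.Propositional using (_⊆_)
open import Data.Product using (Σ; ∃; _×_; _,_)
open import Relation.Binary.PropositionalEquality using (_≡_)

Word : Set
Word = List ℕ

maxW : Word → ℕ
maxW = foldr _⊔_ 0

IsCayley : Word → Set
IsCayley w = All (λ x → 1 ≤ x) w × (∀ i → 1 ≤ i → i ≤ maxW w → i ∈ w)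

standardise : Word → Word
standardise s = map (λ x → length (deduplicate _≟_ (filter (_≤? x) s))) s

Contains : Word → Word → Set
Contains w p = Σ Word (λ s → (s ⊆ w) × (standardise s ≡ p))

Avoids : Word → Word → Set
Avoids w p = Contains w p → (Data.Empty.⊥)
  where import Data.Empty

data Sym : Set where
  slot : Sym
  val  : ℕ → Sym

Config : Set
Config = List Sym

collapse : Config → Config
collapse [] = []
collapse (slot ∷ rest) with collapse rest
... | slot ∷ r = slot ∷ r
... | r        = slot ∷ r
collapse (val x ∷ rest) = val x ∷ collapse rest

numSlots : Config → ℕ
numSlots [] = 0
numSlots (slot ∷ c) = suc (numSlots c)
numSlots (val _ ∷ c) = numSlots c

indexed : Word → List (ℕ × ℕ)
indexed w = zip (upTo (length w)) w

insertedBefore : ℕ × ℕ → ℕ × ℕ → Bool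
insertedBefore (i' , x') (i , x) = (x' <ᵇ x) ∨ ((x' ≡ᵇ x) ∧ (i' <ᵇ i))

-- step at which the entry at (i, x) is inserted (0-based)
insertionTime : Word → ℕ × ℕ → ℕ
insertionTime w p = length (filterᵇ (λ q → insertedBefore q p) (indexed w))

-- configuration of the vertical evolution of w after j insertions (0 ≤ j ≤ |w|)
configuration : Word → ℕ → Config
configuration w j =
  collapse (map (λ p → cell p) (indexed w))
  where
    cell : ℕ × ℕ → Sym
    cell (i , x) = if insertionTime w (i , x) <ᵇ j then val x else slot

InEvolution : Config → Word → Set
InEvolution c w = Σ ℕ (λ j → (j ≤ length w) × (configuration w j ≡ c))

IsDerivation : Word → Config → Set
IsDerivation p c = IsCayley p × InEvolution c p

InSB : ℕ → Word → Set
InSB k w = IsCayley w × (∀ j → j ≤ length w → numSlots (configuration w j) ≤ k)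

slotted : Word → Config
slotted a = slot ∷ concatMap (λ x → val x ∷ slot ∷ []) a

IsBasisElt : ℕ → Word → Set
IsBasisElt k p = (length p ≡ 2 * k + 1) ×
  Σ Word (λ a → IsCayley a × (length a ≡ k) × IsDerivation p (slotted a))

{-# OPTIONS --safe #-}
-- At every stage of the vertical evolution of w the placed entries form a down-set of
-- the insertion order (value first, then position), and conversely every down-set D is exactly what
-- has been placed after |D| insertions; the slots of that configuration are the maximal runs of
-- unplaced entries.  An occurrence of p in w is an order isomorphism between the entries of p and
-- some entries of w, so down-sets can be moved across it in both directions by taking down-closures.
-- Hence a configuration of a basis element with k + 1 slots gives a configuration of w with at least
-- k + 1 slots.  Conversely, a configuration of w with k + 1 slots contains an alternating
-- subsequence  unplaced, placed, …, placed, unplaced  of 2k + 1 entries; standardising it gives a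
-- derivation of ⋄ a₁ ⋄ ⋯ ⋄ aₖ ⋄, and a₁ ⋯ aₖ is Cayley because the values already placed in a Cayley
-- permutation form an initial segment.
module Submission where

open import Data.Bool using (Bool; true; false; T; if_then_else_)
open import Data.Bool.Properties using (T?)
open import Data.Empty using (⊥-elim)
open import Data.List using (List; []; _∷_; length; map; filter; filterᵇ; zip; upTo; deduplicate)
open import Data.List.Properties
  using (length-filter; length-removeAt; length-map; length-upTo; map-∘; map-cong; ∷-injective)
open import Data.List.Membership.Propositional using (_∈_; _∉_; find; lose)
open import Data.List.Membership.Propositional.Properties
  using (∈-map⁺; ∈-map⁻; ∈-filter⁺; ∈-filter⁻; ∈-deduplicate⁺; ∈-deduplicate⁻)
open import Data.List.Relation.Binary.Sublist.Propositional using (_⊆_; []; _∷_; _∷ʳ_; ⊆-refl; minimum)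
open import Data.List.Relation.Binary.Sublist.Propositional.Properties
  using (length-mono-≤; filter⁺; filter-⊆; map⁺; All-resp-⊆; Any-resp-⊆)
open import Data.List.Relation.Unary.All as All using (All; []; _∷_)
import Data.List.Relation.Unary.All.Properties as All
open import Data.List.Relation.Unary.AllPairs as AllPairs using (AllPairs; []; _∷_)
import Data.List.Relation.Unary.AllPairs.Properties as AllPairs
open import Data.List.Relation.Unary.Any as Any using (Any; here; there; any?; _─_)
open import Data.List.Relation.Unary.Unique.Propositional using (Unique)
open import Data.Nat using (ℕ; zero; suc; _+_; _*_; _≤_; _<_; _≤?_; _<ᵇ_; z≤n; s≤s)
open import Data.Nat.Properties
  using (_≟_; <-isStrictTotalOrder; <-cmp; <-irrefl; <-asym; <⇒≢; <⇒≤; <⇒≱; ≮⇒≥; ≰⇒>; ≤∧≢⇒<;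
         ≤-refl; ≤-reflexive; ≤-trans; ≤-antisym; ≤-pred; ≤-<-trans; <-≤-trans; n≤1+n; n<1+n;
         m<n⇒m<1+n; suc-injective; *-suc; ⊔-sel; m≤m⊔n; m≤n⊔m;
         <ᵇ⇒<; <⇒<ᵇ; <ᵇ-reflects-<; ≡ᵇ⇒≡; ≡⇒≡ᵇ; module ≤-Reasoning)
import Data.Product as Product
open import Data.Product using (∃-syntax; _×_; _,_; proj₁; proj₂; swap)
open import Data.Product.Function.NonDependent.Propositional using (_×-⇔_)
open import Data.Product.Relation.Binary.Lex.Strict using (×-Lex; ×-isStrictTotalOrder)
open import Data.Sum using (inj₁; inj₂)
open import Data.Sum.Function.Propositional using (_⊎-⇔_)
open import Function using (_∘_; const; case_of_; _⇔_; mk⇔; Equivalence)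
import Function.Properties.Equivalence as ⇔
open import Relation.Binary.Definitions using (tri<; tri≈; tri>)
open import Relation.Binary.PropositionalEquality
  using (_≡_; _≢_; refl; sym; trans; cong; cong₂; subst; module ≡-Reasoning)
open import Relation.Binary.Structures using (IsStrictTotalOrder)
open import Relation.Nullary using (¬_; Dec; yes; no; contradiction; ¬?; _×-dec_)
open import Relation.Nullary.Decidable using (⌊_⌋; _because_; toWitness; fromWitness; decidable-stable)
open import Relation.Nullary.Reflects
  using (Reflects; ofʸ; ofⁿ; det; fromEquivalence; T-reflects; _⊎-reflects_; _×-reflects_)
open import Data.List.Membership.DecPropositional _≟_ using (_∈?_)
open import Data.List.Relation.Unary.Unique.DecPropositional.Properties _≟_ using (deduplicate-!)

open import Defs

T-injective : ∀ {x y} → T x ⇔ T y → x ≡ y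
T-injective {x} x⇔y = det (T-reflects x) (fromEquivalence (Equivalence.from x⇔y) (Equivalence.to x⇔y))

count : ∀ {A : Set} → (A → Bool) → List A → ℕ
count P xs = length (filterᵇ P xs)

count-mono : ∀ {A : Set} {P Q : A → Bool} xs → (∀ {x} → T (P x) → T (Q x)) → count P xs ≤ count Q xs
count-mono xs P⇒Q = length-mono-≤ (filter⁺ (T? ∘ _) (T? ∘ _) (λ { refl → P⇒Q }) (⊆-refl {x = xs}))

count-strictMono : ∀ {A : Set} {P Q : A → Bool} {xs e} → (∀ {x} → T (P x) → T (Q x)) →
  e ∈ xs → ¬ T (P e) → T (Q e) → count P xs < count Q xs
count-strictMono {P = P} {Q} {x ∷ xs} P⇒Q (here refl) ¬Px Qx with P x | Q x
... | true  | _    = contradiction _ ¬Px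
... | false | true = s≤s (count-mono xs P⇒Q)
count-strictMono {P = P} {Q} {x ∷ xs} P⇒Q (there e∈xs) ¬Pe Qe
  with P x | Q x | P⇒Q {x} | count-strictMono {xs = xs} P⇒Q e∈xs ¬Pe Qe
... | true  | true  | _    | ih = s≤s ih
... | true  | false | P⇒Qx | _  = ⊥-elim (P⇒Qx _)
... | false | true  | _    | ih = m<n⇒m<1+n ih
... | false | false | _    | ih = ih

∈-─ : ∀ {A : Set} {x y : A} {xs} (x∈xs : x ∈ xs) → y ∈ xs → x ≢ y → y ∈ (xs ─ x∈xs)
∈-─ (here refl)  (here refl)  x≢y = contradiction refl x≢y
∈-─ (here _)     (there y∈xs) _   = y∈xs
∈-─ (there _)    (here refl)  _   = here refl
∈-─ (there x∈xs) (there y∈xs) x≢y = there (∈-─ x∈xs y∈xs x≢y)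

unique⇒length-≤ : ∀ {A : Set} {xs ys : List A} → Unique xs → (∀ {x} → x ∈ xs → x ∈ ys) →
  length xs ≤ length ys
unique⇒length-≤ [] _ = z≤n
unique⇒length-≤ {xs = x ∷ xs} {ys} (x∉xs ∷ xs!) xs⊆ys = begin
  suc (length xs)          ≤⟨ s≤s (unique⇒length-≤ xs! λ y∈xs →
                                ∈-─ x∈ys (xs⊆ys (there y∈xs)) (All.lookup x∉xs y∈xs)) ⟩
  suc (length (ys ─ x∈ys)) ≡⟨ length-─ ys x∈ys ⟩
  length ys                ∎
  where
    open ≤-Reasoning
    x∈ys = xs⊆ys (here refl)
    length-─ : ∀ ys (x∈ys : x ∈ ys) → suc (length (ys ─ x∈ys)) ≡ length ys
    length-─ ys@(_ ∷ _) x∈ys = cong suc (length-removeAt ys (Any.index x∈ys))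

module _ {A B : Set} where

  map-proj₁-zip : ∀ {xs : List A} {ys : List B} → length xs ≡ length ys → map proj₁ (zip xs ys) ≡ xs
  map-proj₁-zip {[]}     {[]}     _  = refl
  map-proj₁-zip {x ∷ xs} {y ∷ ys} eq = cong (x ∷_) (map-proj₁-zip (suc-injective eq))

  map-proj₂-zip : ∀ {xs : List A} {ys : List B} → length xs ≡ length ys → map proj₂ (zip xs ys) ≡ ys
  map-proj₂-zip {[]}     {[]}     _  = refl
  map-proj₂-zip {x ∷ xs} {y ∷ ys} eq = cong (y ∷_) (map-proj₂-zip (suc-injective eq))

  ∈-zip⁻ : ∀ {xs : List A} {ys : List B} {z} → z ∈ zip xs ys → proj₁ z ∈ xs × proj₂ z ∈ ys
  ∈-zip⁻ {_ ∷ _} {_ ∷ _} (here refl) = here refl , here refl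
  ∈-zip⁻ {_ ∷ _} {_ ∷ _} (there z∈)  = Product.map there there (∈-zip⁻ z∈)

  module _ {C : Set} {f : A → C} {g : B → C} where

    map-≡⇒zip : ∀ {xs ys} → map f xs ≡ map g ys → ∀ {z} → z ∈ zip xs ys → f (proj₁ z) ≡ g (proj₂ z)
    map-≡⇒zip {_ ∷ _} {_ ∷ _} eq (here refl) = proj₁ (∷-injective eq)
    map-≡⇒zip {_ ∷ _} {_ ∷ _} eq (there z∈)  = map-≡⇒zip (proj₂ (∷-injective eq)) z∈

    zip⇒map-≡ : ∀ {xs ys} → length xs ≡ length ys →
      (∀ {z} → z ∈ zip xs ys → f (proj₁ z) ≡ g (proj₂ z)) → map f xs ≡ map g ys
    zip⇒map-≡ {[]}    {[]}    _  _     = refl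
    zip⇒map-≡ {_ ∷ _} {_ ∷ _} eq agree =
      cong₂ _∷_ (agree (here refl)) (zip⇒map-≡ (suc-injective eq) (agree ∘ there))

⊆-map⁻ : ∀ {A B : Set} (f : A → B) xs {ys} → ys ⊆ map f xs → ∃[ zs ] zs ⊆ xs × map f zs ≡ ys
⊆-map⁻ f []       []           = [] , [] , refl
⊆-map⁻ f (x ∷ xs) (_ ∷ʳ ys⊆)   = let zs , zs⊆ , eq = ⊆-map⁻ f xs ys⊆ in zs , x ∷ʳ zs⊆ , eq
⊆-map⁻ f (x ∷ xs) (refl ∷ ys⊆) = let zs , zs⊆ , eq = ⊆-map⁻ f xs ys⊆ in x ∷ zs , refl ∷ zs⊆ , cong (f x ∷_) eq

AllPairs-resp-⊆ : ∀ {A : Set} {R : A → A → Set} {xs ys} → xs ⊆ ys → AllPairs R ys → AllPairs R xs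
AllPairs-resp-⊆ []           []       = []
AllPairs-resp-⊆ (_ ∷ʳ xs⊆)   (_ ∷ rs) = AllPairs-resp-⊆ xs⊆ rs
AllPairs-resp-⊆ (refl ∷ xs⊆) (r ∷ rs) = All-resp-⊆ xs⊆ r ∷ AllPairs-resp-⊆ xs⊆ rs

maxW-∈ : ∀ {xs} → 1 ≤ maxW xs → maxW xs ∈ xs
maxW-∈ {x ∷ xs} pos with ⊔-sel x (maxW xs)
... | inj₁ x⊔m≡x = subst (_∈ x ∷ xs) (sym x⊔m≡x) (here refl)
... | inj₂ x⊔m≡m = subst (_∈ x ∷ xs) (sym x⊔m≡m) (there (maxW-∈ (subst (1 ≤_) x⊔m≡m pos)))

∈⇒≤maxW : ∀ {x xs} → x ∈ xs → x ≤ maxW xs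
∈⇒≤maxW {xs = y ∷ xs} (here refl)  = m≤m⊔n y (maxW xs)
∈⇒≤maxW {xs = y ∷ xs} (there x∈xs) = ≤-trans (∈⇒≤maxW x∈xs) (m≤n⊔m y (maxW xs))

-- The insertion order

Entry : Set
Entry = ℕ × ℕ

position value : Entry → ℕ
position = proj₁
value    = proj₂

infix 4 _≺_ _≼_ _≺?_ _≼?_

-- Lexicographic on (value, position), the order in which entries are inserted.
_≺_ : Entry → Entry → Set
a ≺ b = ×-Lex _≡_ _<_ _<_ (swap a) (swap b)

_≼_ : Entry → Entry → Set
a ≼ b = ¬ (b ≺ a)

insertedBefore-reflects : ∀ a b → Reflects (a ≺ b) (insertedBefore a b)
insertedBefore-reflects (i , x) (j , y) =
  <ᵇ-reflects-< x y ⊎-reflects (fromEquivalence (≡ᵇ⇒≡ x y) (≡⇒≡ᵇ x y) ×-reflects <ᵇ-reflects-< i j)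

≺⇔insertedBefore : ∀ {a b} → a ≺ b ⇔ T (insertedBefore a b)
≺⇔insertedBefore {a} {b} with insertedBefore a b | insertedBefore-reflects a b
... | true  | ofʸ a≺b = mk⇔ _ (λ _ → a≺b)
... | false | ofⁿ a⊀b = mk⇔ a⊀b (λ ())

_≺?_ : ∀ a b → Dec (a ≺ b)
a ≺? b = insertedBefore a b because insertedBefore-reflects a b

_≼?_ : ∀ a b → Dec (a ≼ b)
a ≼? b = ¬? (b ≺? a)

private
  module Lex = IsStrictTotalOrder (×-isStrictTotalOrder <-isStrictTotalOrder <-isStrictTotalOrder)

≺-irrefl : ∀ {a} → ¬ (a ≺ a)
≺-irrefl = Lex.irrefl (refl , refl)

≺-trans : ∀ {a b c} → a ≺ b → b ≺ c → a ≺ c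
≺-trans = Lex.trans

≺⇒≼ : ∀ {a b} → a ≺ b → a ≼ b
≺⇒≼ a≺b b≺a = ≺-irrefl (≺-trans a≺b b≺a)

≺-≼-trans : ∀ {a b c} → a ≺ b → b ≼ c → a ≺ c
≺-≼-trans {b = b} {c} a≺b b≼c with Lex.compare (swap b) (swap c)
... | tri< b≺c _ _           = ≺-trans a≺b b≺c
... | tri≈ _ (refl , refl) _ = a≺b
... | tri> _ _ c≺b           = contradiction c≺b b≼c

≼-trans : ∀ {a b c} → a ≼ b → b ≼ c → a ≼ c
≼-trans a≼b b≼c c≺a = b≼c (≺-≼-trans c≺a a≼b)

≺⇒value-≤ : ∀ {a b} → a ≺ b → value a ≤ value b
≺⇒value-≤ (inj₁ x<y)       = <⇒≤ x<y
≺⇒value-≤ (inj₂ (x≡y , _)) = ≤-reflexive x≡y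

≺-cong : ∀ {a a′ b b′} →
  (value a < value a′ ⇔ value b < value b′) → (value a ≡ value a′ ⇔ value b ≡ value b′) →
  (position a < position a′ ⇔ position b < position b′) → a ≺ a′ ⇔ b ≺ b′
≺-cong v< v≡ p< = v< ⊎-⇔ (v≡ ×-⇔ p<)

-- Placed entries and down-sets

-- insertionTime w = timeIn (indexed w), so configuration w j shows exactly the entries e of
-- indexed w with placedAt (indexed w) j e.
timeIn : List Entry → Entry → ℕ
timeIn L e = count (λ q → insertedBefore q e) L

placedAt : List Entry → ℕ → Entry → Bool
placedAt L j e = timeIn L e <ᵇ j

DownClosed : (Entry → Bool) → Set
DownClosed D = ∀ {a b} → a ≼ b → T (D b) → T (D a)

timeIn-mono : ∀ L {a b} → a ≼ b → timeIn L a ≤ timeIn L b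
timeIn-mono L {a} {b} a≼b = count-mono L λ {q} q≺a →
  Equivalence.to ≺⇔insertedBefore (≺-≼-trans (Equivalence.from (≺⇔insertedBefore {q} {a}) q≺a) a≼b)

placedAt-downClosed : ∀ L j → DownClosed (placedAt L j)
placedAt-downClosed L j {a} {b} a≼b b-placed =
  <⇒<ᵇ (≤-<-trans (timeIn-mono L a≼b) (<ᵇ⇒< (timeIn L b) j b-placed))

placedAt-count : ∀ {D} L {e} → DownClosed D → e ∈ L → placedAt L (count D L) e ≡ D e
placedAt-count {D} L {e} down e∈L = T-injective (mk⇔ placed⇒D D⇒placed)
  where
    placed⇒D : T (placedAt L (count D L) e) → T (D e)
    placed⇒D placed = decidable-stable (T? (D e)) λ ¬De →
      <⇒≱ (<ᵇ⇒< _ _ placed) (count-mono L λ {q} Dq →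
        Equivalence.to ≺⇔insertedBefore (decidable-stable (q ≺? e) λ e≼q → ¬De (down e≼q Dq)))
    D⇒placed : T (D e) → T (placedAt L (count D L) e)
    D⇒placed De = <⇒<ᵇ (count-strictMono
      (λ {q} q≺e → down (≺⇒≼ (Equivalence.from (≺⇔insertedBefore {q} {e}) q≺e)) De)
      e∈L (≺-irrefl ∘ Equivalence.from (≺⇔insertedBefore {e} {e})) De)

-- Transporting down-sets along order isomorphisms

Pairing : Set
Pairing = List (Entry × Entry)

OrderIso : Pairing → Set
OrderIso Z = ∀ {z z′} → z ∈ Z → z′ ∈ Z → proj₁ z ≺ proj₁ z′ ⇔ proj₂ z ≺ proj₂ z′

orderIso-swap : ∀ {Z} → OrderIso Z → OrderIso (map swap Z)
orderIso-swap iso z∈ z′∈ with ∈-map⁻ swap z∈ | ∈-map⁻ swap z′∈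
... | _ , z∈Z , refl | _ , z′∈Z , refl = ⇔.sym (iso z∈Z z′∈Z)

downClosure : Pairing → (Entry → Bool) → Entry → Bool
downClosure Z P q = ⌊ any? (λ z → T? (P (proj₁ z)) ×-dec (q ≼? proj₂ z)) Z ⌋

downClosure⇔ : ∀ {Z P q} → T (downClosure Z P q) ⇔ Any (λ z → T (P (proj₁ z)) × q ≼ proj₂ z) Z
downClosure⇔ {Z} {P} {q} = mk⇔ (toWitness {a? = dec}) (fromWitness {a? = dec})
  where dec = any? (λ z → T? (P (proj₁ z)) ×-dec (q ≼? proj₂ z)) Z

downClosure-downClosed : ∀ Z P → DownClosed (downClosure Z P)
downClosure-downClosed Z P a≼b =
  Equivalence.from downClosure⇔ ∘ Any.map (Product.map₂ (≼-trans a≼b)) ∘ Equivalence.to downClosure⇔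

downClosure-agrees : ∀ {Z P z} → OrderIso Z → DownClosed P → z ∈ Z →
  downClosure Z P (proj₂ z) ≡ P (proj₁ z)
downClosure-agrees {Z} {P} {z} iso down z∈Z = T-injective (mk⇔ dominated⇒P P⇒dominated)
  where
    P⇒dominated : T (P (proj₁ z)) → T (downClosure Z P (proj₂ z))
    P⇒dominated Pz = Equivalence.from downClosure⇔ (lose z∈Z (Pz , ≺-irrefl))
    dominated⇒P : T (downClosure Z P (proj₂ z)) → T (P (proj₁ z))
    dominated⇒P dom with find (Equivalence.to downClosure⇔ dom)
    ... | z′ , z′∈Z , Pz′ , z≼z′ = down (z≼z′ ∘ Equivalence.to (iso z′∈Z z∈Z)) Pz′

synchronise : ∀ {Z P} L → OrderIso Z → DownClosed P → (∀ {z} → z ∈ Z → proj₂ z ∈ L) →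
  ∃[ d ] d ≤ length L × (∀ {z} → z ∈ Z → placedAt L d (proj₂ z) ≡ P (proj₁ z))
synchronise {Z} {P} L iso down ⊆L =
  count D L , length-filter (T? ∘ D) L ,
  λ z∈Z → trans (placedAt-count L (downClosure-downClosed Z P) (⊆L z∈Z)) (downClosure-agrees iso down z∈Z)
  where D = downClosure Z P

module StrictlyMonotoneOn {S : ℕ → Set} {f : ℕ → ℕ} (f-mono : ∀ {x y} → S y → x < y → f x < f y) where

  <-⇔ : ∀ {x y} → S x → S y → x < y ⇔ f x < f y
  <-⇔ {x} {y} Sx Sy = mk⇔ (f-mono Sy) reflect
    where
      reflect : f x < f y → x < y
      reflect fx<fy with <-cmp x y
      ... | tri< x<y _ _  = x<y
      ... | tri≈ _ refl _ = contradiction fx<fy (<-irrefl refl)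
      ... | tri> _ _ y<x  = contradiction fx<fy (<-asym (f-mono Sx y<x))

  ≡-⇔ : ∀ {x y} → S x → S y → x ≡ y ⇔ f x ≡ f y
  ≡-⇔ {x} {y} Sx Sy = mk⇔ (cong f) reflect
    where
      reflect : f x ≡ f y → x ≡ y
      reflect fx≡fy with <-cmp x y
      ... | tri< x<y _ _ = contradiction fx≡fy (<⇒≢ (f-mono Sy x<y))
      ... | tri≈ _ x≡y _ = x≡y
      ... | tri> _ _ y<x = contradiction (sym fx≡fy) (<⇒≢ (f-mono Sx y<x))

  BothIncrease : Entry × Entry → Entry × Entry → Set
  BothIncrease (a , b) (a′ , b′) = position a < position a′ × position b < position b′

  Relabelled : Entry × Entry → Set
  Relabelled (a , b) = S (value a) × value b ≡ f (value a)

  relabelled-≺-⇔ : ∀ {a b a′ b′} → Relabelled (a , b) → Relabelled (a′ , b′) →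
    (position a < position a′ ⇔ position b < position b′) → a ≺ a′ ⇔ b ≺ b′
  relabelled-≺-⇔ (Sx , refl) (Sx′ , refl) = ≺-cong (<-⇔ Sx Sx′) (≡-⇔ Sx Sx′)

  orderIso-of-increasing : ∀ {Z} → AllPairs BothIncrease Z → All Relabelled Z → OrderIso Z
  orderIso-of-increasing (_ ∷ _) (r ∷ _) (here refl) (here refl) =
    relabelled-≺-⇔ r r (mk⇔ (⊥-elim ∘ <-irrefl refl) (⊥-elim ∘ <-irrefl refl))
  orderIso-of-increasing (inc ∷ _) (r ∷ rs) (here refl) (there z′∈Z) with All.lookup inc z′∈Z
  ... | i<i′ , k<k′ = relabelled-≺-⇔ r (All.lookup rs z′∈Z) (mk⇔ (const k<k′) (const i<i′))
  orderIso-of-increasing (inc ∷ _) (r ∷ rs) (there z∈Z) (here refl) with All.lookup inc z∈Z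
  ... | i′<i , k′<k =
    relabelled-≺-⇔ (All.lookup rs z∈Z) r (mk⇔ (⊥-elim ∘ <-asym i′<i) (⊥-elim ∘ <-asym k′<k))
  orderIso-of-increasing (_ ∷ incs) (_ ∷ rs) (there z∈Z) (there z′∈Z) =
    orderIso-of-increasing incs rs z∈Z z′∈Z

-- Standardisation and Cayley permutations

-- standardise s = map (rank s) s, definitionally.
below : List ℕ → ℕ → List ℕ
below s v = deduplicate _≟_ (filter (_≤? v) s)

rank : List ℕ → ℕ → ℕ
rank s v = length (below s v)

module _ {s : List ℕ} where

  ∈-below⁺ : ∀ {a v} → a ∈ s → a ≤ v → a ∈ below s v
  ∈-below⁺ {v = v} a∈s a≤v = ∈-deduplicate⁺ _≟_ (∈-filter⁺ (_≤? v) a∈s a≤v)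

  ∈-below⁻ : ∀ {a v} → a ∈ below s v → a ∈ s × a ≤ v
  ∈-below⁻ {v = v} a∈ = ∈-filter⁻ (_≤? v) (∈-deduplicate⁻ _≟_ (filter (_≤? v) s) a∈)

  below-unique : ∀ v → Unique (below s v)
  below-unique v = deduplicate-! (filter (_≤? v) s)

  rank-strictMono : ∀ {x y} → y ∈ s → x < y → rank s x < rank s y
  rank-strictMono {x} {y} y∈s x<y = unique⇒length-≤ (All.tabulate y≢ ∷ below-unique x) ⊆below
    where
      y≢ : ∀ {a} → a ∈ below s x → y ≢ a
      y≢ a∈ refl = <⇒≱ x<y (proj₂ (∈-below⁻ a∈))
      ⊆below : ∀ {a} → a ∈ y ∷ below s x → a ∈ below s y
      ⊆below (here refl) = ∈-below⁺ y∈s ≤-refl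
      ⊆below (there a∈)  = ∈-below⁺ (proj₁ (∈-below⁻ a∈)) (≤-trans (proj₂ (∈-below⁻ a∈)) (<⇒≤ x<y))

  rank-suc-≤ : ∀ v → rank s (suc v) ≤ suc (rank s v)
  rank-suc-≤ v = unique⇒length-≤ (below-unique (suc v)) ⊆below
    where
      ⊆below : ∀ {a} → a ∈ below s (suc v) → a ∈ suc v ∷ below s v
      ⊆below {a} a∈ with a ≟ suc v | ∈-below⁻ a∈
      ... | yes refl | _           = here refl
      ... | no a≢    | a∈s , a≤1+v = there (∈-below⁺ a∈s (≤-pred (≤∧≢⇒< a≤1+v a≢)))

  rank-suc-jump : ∀ v → rank s v < rank s (suc v) → suc v ∈ s
  rank-suc-jump v jump = decidable-stable (suc v ∈? s) λ 1+v∉s →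
    <⇒≱ jump (unique⇒length-≤ (below-unique (suc v)) (⊆below 1+v∉s))
    where
      ⊆below : suc v ∉ s → ∀ {a} → a ∈ below s (suc v) → a ∈ below s v
      ⊆below 1+v∉s {a} a∈ with a ≟ suc v | ∈-below⁻ a∈
      ... | yes refl | a∈s , _     = contradiction a∈s 1+v∉s
      ... | no a≢    | a∈s , a≤1+v = ∈-below⁺ a∈s (≤-pred (≤∧≢⇒< a≤1+v a≢))

  rank-zero-≤ : rank s 0 ≤ 1
  rank-zero-≤ = unique⇒length-≤ {ys = 0 ∷ []} (below-unique 0) λ a∈ →
    case ∈-below⁻ a∈ of λ { (_ , z≤n) → here refl }

  rank-zero-pos : 0 < rank s 0 → 0 ∈ s
  rank-zero-pos _ with below s 0 in eq
  ... | a ∷ _ = case ∈-below⁻ (subst (a ∈_) (sym eq) (here refl)) of λ { (a∈s , z≤n) → a∈s }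

  rank-pos : ∀ {x} → x ∈ s → 0 < rank s x
  rank-pos x∈s = unique⇒length-≤ {xs = _ ∷ []} ([] ∷ []) λ { (here refl) → ∈-below⁺ x∈s ≤-refl }

  rank-surjective : ∀ x {i} → 0 < i → i ≤ rank s x → ∃[ v ] v ∈ s × rank s v ≡ i
  rank-surjective zero    0<i i≤r =
    0 , rank-zero-pos (<-≤-trans 0<i i≤r) , ≤-antisym (≤-trans rank-zero-≤ 0<i) i≤r
  rank-surjective (suc x) {i} 0<i i≤r with i ≤? rank s x
  ... | yes i≤r′ = rank-surjective x 0<i i≤r′
  ... | no  i≰r′ = suc x , rank-suc-jump x (<-≤-trans (≰⇒> i≰r′) i≤r) ,
                   ≤-antisym (≤-trans (rank-suc-≤ x) (≰⇒> i≰r′)) i≤r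

DownwardClosedValues : Word → Set
DownwardClosedValues w = ∀ {i y} → 1 ≤ i → y ∈ w → i ≤ y → i ∈ w

cayley-intro : ∀ {w} → All (1 ≤_) w → DownwardClosedValues w → IsCayley w
cayley-intro pos closed = pos , λ i 1≤i i≤max → closed 1≤i (maxW-∈ (≤-trans 1≤i i≤max)) i≤max

cayley-closed : ∀ {w} → IsCayley w → DownwardClosedValues w
cayley-closed (_ , cover) 1≤i y∈w i≤y = cover _ 1≤i (≤-trans i≤y (∈⇒≤maxW y∈w))

standardise-cayley : ∀ s → IsCayley (standardise s)
standardise-cayley s = cayley-intro (All.map⁺ (All.tabulate (rank-pos {s}))) closed
  where
    closed : DownwardClosedValues (standardise s)
    closed 1≤i y∈ i≤y with ∈-map⁻ (rank s) y∈
    ... | x , x∈s , refl with rank-surjective {s} x 1≤i i≤y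
    ... | v , v∈s , refl = ∈-map⁺ (rank s) v∈s

placedValues-cayley : ∀ {D L} → DownClosed D → IsCayley (map value L) →
  IsCayley (map value (filterᵇ D L))
placedValues-cayley {D} {L} down cay =
  cayley-intro (All-resp-⊆ (map⁺ value (filter-⊆ (T? ∘ D) L)) (proj₁ cay)) closed
  where
    closed : DownwardClosedValues (map value (filterᵇ D L))
    closed 1≤i y∈ i≤y with ∈-map⁻ value y∈
    ... | q′ , q′∈ , refl with ∈-filter⁻ (T? ∘ D) q′∈
    ... | q′∈L , Dq′ with ∈-map⁻ value (cayley-closed cay 1≤i (∈-map⁺ value q′∈L) i≤y)
    ... | q , q∈L , refl with T? (D q)
    ... | yes Dq = ∈-map⁺ value (∈-filter⁺ (T? ∘ D) q∈L Dq)
    ... | no ¬Dq = subst (_∈ _) (≤-antisym (≺⇒value-≤ q′≺q) i≤y) y∈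
      where q′≺q = decidable-stable (q′ ≺? q) (λ q≼q′ → ¬Dq (down q≼q′ Dq′))

-- Counting slots

-- gaps inGap bs counts the maximal runs of false in bs; inGap says that bs continues such a run.
gaps : Bool → List Bool → ℕ
gaps _     []           = 0
gaps _     (true  ∷ bs) = gaps false bs
gaps false (false ∷ bs) = suc (gaps true bs)
gaps true  (false ∷ bs) = gaps true bs

gaps-true-≤ : ∀ bs → gaps true bs ≤ gaps false bs
gaps-true-≤ []           = z≤n
gaps-true-≤ (true  ∷ bs) = ≤-refl
gaps-true-≤ (false ∷ bs) = n≤1+n _

gaps-false-≤ : ∀ bs → gaps false bs ≤ suc (gaps true bs)
gaps-false-≤ []           = z≤n
gaps-false-≤ (true  ∷ bs) = n≤1+n _
gaps-false-≤ (false ∷ bs) = ≤-refl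

gaps-mono : ∀ {xs ys} → xs ⊆ ys → ∀ inGap → gaps inGap xs ≤ gaps inGap ys
gaps-mono []                       _     = z≤n
gaps-mono {xs} (true ∷ʳ xs⊆ys)     true  = ≤-trans (gaps-true-≤ xs) (gaps-mono xs⊆ys false)
gaps-mono      (true ∷ʳ xs⊆ys)     false = gaps-mono xs⊆ys false
gaps-mono      (false ∷ʳ xs⊆ys)    true  = gaps-mono xs⊆ys true
gaps-mono {xs} (false ∷ʳ xs⊆ys)    false = ≤-trans (gaps-false-≤ xs) (s≤s (gaps-mono xs⊆ys true))
gaps-mono (_∷_ {true}  refl xs⊆ys) _     = gaps-mono xs⊆ys false
gaps-mono (_∷_ {false} refl xs⊆ys) true  = gaps-mono xs⊆ys true
gaps-mono (_∷_ {false} refl xs⊆ys) false = s≤s (gaps-mono xs⊆ys true)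

alternating : ℕ → List Bool
alternating zero    = false ∷ []
alternating (suc k) = false ∷ true ∷ alternating k

length-alternating : ∀ k → length (alternating k) ≡ 2 * k + 1
length-alternating zero    = refl
length-alternating (suc k) = trans (cong (2 +_) (length-alternating k)) (cong (_+ 1) (sym (*-suc 2 k)))

mutual
  alternating-⊆ : ∀ k bs → k < gaps false bs → alternating k ⊆ bs
  alternating-⊆ k       (true  ∷ bs) k<gaps       = true ∷ʳ alternating-⊆ k bs k<gaps
  alternating-⊆ zero    (false ∷ bs) _            = refl ∷ minimum bs
  alternating-⊆ (suc k) (false ∷ bs) (s≤s k<gaps) = refl ∷ true∷alternating-⊆ k bs k<gaps

  true∷alternating-⊆ : ∀ k bs → k < gaps true bs → true ∷ alternating k ⊆ bs
  true∷alternating-⊆ k (true  ∷ bs) k<gaps = refl ∷ alternating-⊆ k bs k<gaps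
  true∷alternating-⊆ k (false ∷ bs) k<gaps = false ∷ʳ true∷alternating-⊆ k bs k<gaps

isVal : Sym → Bool
isVal slot    = false
isVal (val _) = true

collapse-slot : ∀ c → ∃[ r ] collapse (slot ∷ c) ≡ slot ∷ r
collapse-slot c with collapse c
... | []        = [] , refl
... | slot ∷ r  = r , refl
... | val x ∷ r = val x ∷ r , refl

mutual
  numSlots-collapse : ∀ c → numSlots (collapse c) ≡ gaps false (map isVal c)
  numSlots-collapse []          = refl
  numSlots-collapse (val _ ∷ c) = numSlots-collapse c
  numSlots-collapse (slot ∷ c)  = numSlots-collapse-slot c

  numSlots-collapse-slot : ∀ c → numSlots (collapse (slot ∷ c)) ≡ suc (gaps true (map isVal c))
  numSlots-collapse-slot []          = refl
  numSlots-collapse-slot (val _ ∷ c) = cong suc (numSlots-collapse c)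
  numSlots-collapse-slot (slot ∷ c)
    with collapse (slot ∷ c) | collapse-slot c | numSlots-collapse-slot c
  ... | _ | _ , refl | ih = ih

cell : (Entry → Bool) → Entry → Sym
cell D q = if D q then val (value q) else slot

numSlots-configuration : ∀ w j →
  numSlots (configuration w j) ≡ gaps false (map (placedAt (indexed w) j) (indexed w))
numSlots-configuration w j = begin
  numSlots (collapse (map (cell D) (indexed w)))    ≡⟨ numSlots-collapse (map (cell D) (indexed w)) ⟩
  gaps false (map isVal (map (cell D) (indexed w))) ≡⟨ cong (gaps false) (map-∘ (indexed w)) ⟨
  gaps false (map (isVal ∘ cell D) (indexed w))     ≡⟨ cong (gaps false) (map-cong isVal-cell (indexed w)) ⟩
  gaps false (map D (indexed w))                    ∎
  where
    open ≡-Reasoning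
    D = placedAt (indexed w) j
    isVal-cell : ∀ q → isVal (cell D q) ≡ D q
    isVal-cell q with D q
    ... | true  = refl
    ... | false = refl

collapse-slotted : ∀ a → collapse (slotted a) ≡ slotted a
collapse-slotted []      = refl
collapse-slotted (x ∷ a) = cong (λ c → slot ∷ val x ∷ c) (collapse-slotted a)

numSlots-slotted : ∀ a → numSlots (slotted a) ≡ suc (length a)
numSlots-slotted []      = refl
numSlots-slotted (x ∷ a) = cong suc (numSlots-slotted a)

cells-alternating : ∀ {D} k L → map D L ≡ alternating k →
  map (cell D) L ≡ slotted (map value (filterᵇ D L)) × count D L ≡ k
cells-alternating zero (q ∷ []) eq rewrite proj₁ (∷-injective eq) = refl , refl
cells-alternating (suc k) (q ∷ q′ ∷ L) eq
  with ∷-injective eq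
... | Dq≡false , eq′ with ∷-injective eq′
... | Dq′≡true , eq″ rewrite Dq≡false | Dq′≡true with cells-alternating k L eq″
... | cells , count≡k = cong (λ c → slot ∷ val (value q′) ∷ c) cells , cong suc count≡k

-- Occurrences

values-indexed : ∀ w → map value (indexed w) ≡ w
values-indexed w = map-proj₂-zip (length-upTo (length w))

length-indexed : ∀ w → length (indexed w) ≡ length w
length-indexed w = trans (sym (length-map value (indexed w))) (cong length (values-indexed w))

Increasing : List Entry → Set
Increasing = AllPairs (λ a b → position a < position b)

indexed-increasing : ∀ w → Increasing (indexed w)
indexed-increasing w =
  AllPairs.map⁻ (subst (AllPairs _<_) (sym positions) (AllPairs.applyUpTo⁺₁ _ (length w) const))
  where positions = map-proj₁-zip {xs = upTo (length w)} (length-upTo (length w))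

lift-subsequence : ∀ {s w} → s ⊆ w → ∃[ T ] T ⊆ indexed w × map value T ≡ s
lift-subsequence {w = w} s⊆w = ⊆-map⁻ value (indexed w) (subst (_ ⊆_) (sym (values-indexed w)) s⊆w)

patternOf : List Entry → Word
patternOf T = standardise (map value T)

length-patternOf : ∀ T → length T ≡ length (indexed (patternOf T))
length-patternOf T = sym (begin
  length (indexed (patternOf T)) ≡⟨ length-indexed (patternOf T) ⟩
  length (patternOf T)           ≡⟨ length-map (rank (map value T)) (map value T) ⟩
  length (map value T)           ≡⟨ length-map value T ⟩
  length T                       ∎)
  where open ≡-Reasoning

occurrence-orderIso : ∀ {T} → Increasing T → OrderIso (zip T (indexed (patternOf T)))
occurrence-orderIso {T} T-inc =
  orderIso-of-increasing (AllPairs.zip (on-proj₁ , on-proj₂)) (All.tabulate relabelled)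
  where
    s  = map value T
    Lp = indexed (patternOf T)
    open StrictlyMonotoneOn {S = _∈ s} {f = rank s} rank-strictMono
    on-proj₁ = AllPairs.map⁻ (subst Increasing (sym (map-proj₁-zip (length-patternOf T))) T-inc)
    on-proj₂ = AllPairs.map⁻ (subst Increasing (sym (map-proj₂-zip (length-patternOf T)))
                                    (indexed-increasing (patternOf T)))
    ranks : map (rank s ∘ value) T ≡ map value Lp
    ranks = trans (map-∘ T) (sym (values-indexed (patternOf T)))
    relabelled : ∀ {z} → z ∈ zip T Lp → Relabelled z
    relabelled z∈ = ∈-map⁺ value (proj₁ (∈-zip⁻ z∈)) , sym (map-≡⇒zip ranks z∈)

realise-in-pattern : ∀ {T P} → Increasing T → DownClosed P →
  ∃[ d ] d ≤ length (patternOf T) ×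
         map (placedAt (indexed (patternOf T)) d) (indexed (patternOf T)) ≡ map P T
realise-in-pattern {T} T-inc down
  with synchronise (indexed (patternOf T)) (occurrence-orderIso T-inc) down (proj₂ ∘ ∈-zip⁻)
... | d , d≤ , agree =
  d , subst (d ≤_) (length-indexed (patternOf T)) d≤ , sym (zip⇒map-≡ (length-patternOf T) (sym ∘ agree))

realise-in-word : ∀ {T L P} → Increasing T → T ⊆ L → DownClosed P →
  ∃[ d ] d ≤ length L × map (placedAt L d) T ≡ map P (indexed (patternOf T))
realise-in-word {T} {L} T-inc T⊆L down
  with synchronise L (orderIso-swap (occurrence-orderIso T-inc)) down in-L
  where
    in-L : ∀ {z} → z ∈ map swap (zip T (indexed (patternOf T))) → proj₂ z ∈ L
    in-L z∈ with ∈-map⁻ swap z∈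
    ... | _ , z∈Z , refl = Any-resp-⊆ T⊆L (proj₁ (∈-zip⁻ z∈Z))
... | d , d≤ , agree = d , d≤ , zip⇒map-≡ (length-patternOf T) (agree ∘ ∈-map⁺ swap)

inSB⇒avoids-basis : ∀ {k w} → InSB k w → ∀ p → IsBasisElt k p → Avoids w p
inSB⇒avoids-basis {k} {w} (_ , bounded) _ (_ , a , _ , |a|≡k , _ , j , _ , config≡) (_ , s⊆w , refl)
  with lift-subsequence s⊆w
... | T , T⊆w , refl
  with realise-in-word (AllPairs-resp-⊆ T⊆w (indexed-increasing w)) T⊆w
                       (placedAt-downClosed (indexed (patternOf T)) j)
... | d , d≤ , agree = <⇒≱ too-many (bounded d (subst (d ≤_) (length-indexed w) d≤))
  where
    open ≤-Reasoning
    Lp = indexed (patternOf T)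
    Lw = indexed w
    too-many : k < numSlots (configuration w d)
    too-many = begin-strict
      k                                        <⟨ n<1+n k ⟩
      suc k                                    ≡⟨ cong suc |a|≡k ⟨
      suc (length a)                           ≡⟨ numSlots-slotted a ⟨
      numSlots (slotted a)                     ≡⟨ cong numSlots config≡ ⟨
      numSlots (configuration (patternOf T) j) ≡⟨ numSlots-configuration (patternOf T) j ⟩
      gaps false (map (placedAt Lp j) Lp)      ≡⟨ cong (gaps false) agree ⟨
      gaps false (map (placedAt Lw d) T)       ≤⟨ gaps-mono (map⁺ (placedAt Lw d) T⊆w) false ⟩
      gaps false (map (placedAt Lw d) Lw)      ≡⟨ numSlots-configuration w d ⟨
      numSlots (configuration w d)             ∎

wide-configuration⇒basis : ∀ {k w j} → k < numSlots (configuration w j) →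
  ∃[ p ] IsBasisElt k p × Contains w p
wide-configuration⇒basis {k} {w} {j} wide
  with ⊆-map⁻ (placedAt (indexed w) j) (indexed w)
              (alternating-⊆ k _ (subst (k <_) (numSlots-configuration w j) wide))
... | T , T⊆w , T-alternates
  with realise-in-pattern (AllPairs-resp-⊆ T⊆w (indexed-increasing w)) (placedAt-downClosed (indexed w) j)
... | d , d≤ , agree =
  p , (length-p , a , a-cayley , |a|≡k , standardise-cayley _ , d , d≤ , config≡) , contains
  where
    p  = patternOf T
    Lp = indexed p
    alternates : map (placedAt Lp d) Lp ≡ alternating k
    alternates = trans agree T-alternates
    a = map value (filterᵇ (placedAt Lp d) Lp)
    |a|≡k : length a ≡ k
    |a|≡k = trans (length-map value (filterᵇ (placedAt Lp d) Lp)) (proj₂ (cells-alternating k Lp alternates))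
    length-p : length p ≡ 2 * k + 1
    length-p = begin
      length p                        ≡⟨ length-indexed p ⟨
      length Lp                       ≡⟨ length-map (placedAt Lp d) Lp ⟨
      length (map (placedAt Lp d) Lp) ≡⟨ cong length alternates ⟩
      length (alternating k)          ≡⟨ length-alternating k ⟩
      2 * k + 1                       ∎
      where open ≡-Reasoning
    a-cayley : IsCayley a
    a-cayley = placedValues-cayley (placedAt-downClosed Lp d)
                                   (subst IsCayley (sym (values-indexed p)) (standardise-cayley _))
    config≡ : configuration p d ≡ slotted a
    config≡ = trans (cong collapse (proj₁ (cells-alternating k Lp alternates))) (collapse-slotted a)
    contains : Contains w p
    contains = map value T , subst (_ ⊆_) (values-indexed w) (map⁺ value T⊆w) , refl

proposition3p1 : (k : ℕ) → 1 ≤ k → (w : Word) → IsCayley w →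
    (InSB k w → (∀ p → IsBasisElt k p → Avoids w p)) ×
    ((∀ p → IsBasisElt k p → Avoids w p) → InSB k w)
proposition3p1 k _ w w-cayley = inSB⇒avoids-basis , avoids⇒inSB
  where
    avoids⇒inSB : (∀ p → IsBasisElt k p → Avoids w p) → InSB k w
    avoids⇒inSB avoids = w-cayley , λ j _ → ≮⇒≥ λ wide →
      let p , basis , contains = wide-configuration⇒basis {j = j} wide in avoids p basis contains
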